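{- Let $t_1<\dots<t_n$ be timestamps, $I\subseteq\mathbb{R}_{\ge0}$ an interval with endpoints in $\mathbb{N}\cup\{\infty\}$, and $s\in\{\bot,\top\}^n$. Let $C$ be the circuit with inputs $\varphi_1,\dots,\varphi_n$ defined below. For any $p\in\{\bot,\top\}^n$, if each input $\varphi_i$ is set to $p(i)$, then for every $1\le j\le n$ the output gate $o_j$ evaluates to $\top$ if and only if $(s\,\mathbf{U}_I\,p)(j)=\top$.
   Context: Here $(s\,\mathbf{U}_I\,p)(i)=\top$ iff there is $j$ with $i\le j\le n$, $t_j-t_i\in I$, $p(j)=\top$ and $s(k)=\top$ for all $i\le k<j$. Circuit construction: for each $i$ let $T_i=\{j: t_j-t_i\in I\}$; if $T_i\ne\emptyset$, let $\mathrm{first}(i)=\min T_i$, $\mathrm{last}(i)=\max T_i$, $\mathrm{seg}(i)=\min\{j\ge i: s(j)=\bot\}$ (taken to be $+\infty$ if no such $j$ exists), $L_i=\mathrm{first}(i)$ and $R_i=\min(\mathrm{last}(i),\mathrm{seg}(i))$. The circuit has an internal gate $d_{p,q}$ for every pair $p\le q$ such that $L_i\le p\le q\le R_i$ for some $i$; $d_{p,p}$ is an identity gate fed by input $\varphi_p$, and for $p<q$, $d_{p,q}$ is an OR gate with predecessors $d_{p,q-1}$ and $d_{p+1,q}$. The output gate $o_i$ is the constant $\bot$ if $T_i=\emptyset$ or $L_i>R_i$, and otherwise an identity gate fed by $d_{L_i,R_i}$.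
   Formalization: The timestamps $t_1<\dots<t_n$ take rational values. -}

module Defs where

open import Data.Bool using (Bool; true; false; _∨_; if_then_else_)
open import Data.Nat as ℕ using (ℕ; zero; suc; _∸_)
import Data.Nat.Properties as ℕP
open import Data.Integer using (+_)
open import Data.Rational as ℚ using (ℚ; _/_; _-_)
import Data.Rational.Properties as ℚP
open import Data.Maybe using (Maybe; just; nothing)
open import Data.Product using (_×_; _,_; Σ)
open import Data.Sum using (_⊎_)
open import Data.Unit using (⊤)
open import Data.Empty using (⊥)
open import Relation.Nullary using (Dec; yes; no)
open import Relation.Nullary.Decidable using (_×-dec_)

-- Indices are 0-based: positions 0 … n-1 (paper: 1 … n).
-- Truth values: ⊤ = true, ⊥ = false.

ℕ→ℚ : ℕ → ℚ
ℕ→ℚ k = + k / 1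

-- Intervals I ⊆ ℝ≥0 with endpoints in ℕ ∪ {∞}, each end open or closed.
-- upper = nothing means the right endpoint is ∞ (then the end is open).

record Interval : Set where
  constructor interval
  field
    lower       : ℕ
    lowerClosed : Bool
    upper       : Maybe ℕ
    upperClosed : Bool
open Interval public

LowerOK : Bool → ℕ → ℚ → Set
LowerOK true  a x = ℕ→ℚ a ℚ.≤ x
LowerOK false a x = ℕ→ℚ a ℚ.< x

UpperOK : Bool → Maybe ℕ → ℚ → Set
UpperOK _     nothing  x = ⊤
UpperOK true  (just b) x = x ℚ.≤ ℕ→ℚ b
UpperOK false (just b) x = x ℚ.< ℕ→ℚ b

_∈I_ : ℚ → Interval → Set
x ∈I I = LowerOK (lowerClosed I) (lower I) x × UpperOK (upperClosed I) (upper I) x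

lowerOK? : ∀ c a x → Dec (LowerOK c a x)
lowerOK? true  a x = ℕ→ℚ a ℚ.≤? x
  where open ℚP
lowerOK? false a x = ℕ→ℚ a ℚP.<? x

upperOK? : ∀ c b x → Dec (UpperOK c b x)
upperOK? _     nothing  x = yes Data.Unit.tt
upperOK? true  (just b) x = x ℚP.≤? ℕ→ℚ b
upperOK? false (just b) x = x ℚP.<? ℕ→ℚ b

_∈I?_ : ∀ x I → Dec (x ∈I I)
x ∈I? I = lowerOK? (lowerClosed I) (lower I) x ×-dec upperOK? (upperClosed I) (upper I) x

isTrue : ∀ {A : Set} → Dec A → Bool
isTrue (yes _) = true
isTrue (no  _) = false

UntilHolds : (n : ℕ) (t : ℕ → ℚ) (I : Interval) (s p : ℕ → Bool) (i : ℕ) → Set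
UntilHolds n t I s p i =
  Σ ℕ λ j → (i ℕ.≤ j) × (j ℕ.< n) × ((t j - t i) ∈I I) × (p j ≡ true)
          × (∀ k → i ℕ.≤ k → k ℕ.< j → s k ≡ true)
  where open import Relation.Binary.PropositionalEquality using (_≡_)

-- Boolean circuits (gates given as expressions; a shared gate is a shared
-- subexpression, so evaluation coincides with DAG evaluation).

data Gate : Set where
  input : ℕ → Gate
  const : Bool → Gate
  idG   : Gate → Gate
  orG   : Gate → Gate → Gate

eval : (ℕ → Bool) → Gate → Bool
eval φ (input k) = φ k
eval φ (const b) = b
eval φ (idG g)   = eval φ g
eval φ (orG g h) = eval φ g ∨ eval φ h

-- dSpan p k is the gate d_{p,p+k}:
--   d_{p,p} = id(φ_p),  d_{p,q} = OR(d_{p,q-1}, d_{p+1,q}) for p < q.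
dSpan : ℕ → ℕ → Gate
dSpan p zero    = idG (input p)
dSpan p (suc k) = orG (dSpan p k) (dSpan (suc p) k)

d : ℕ → ℕ → Gate
d p q = dSpan p (q ∸ p)

searchUp : (ℕ → Bool) → ℕ → ℕ → Maybe ℕ
searchUp f lo zero      = nothing
searchUp f lo (suc len) = if f lo then just lo else searchUp f (suc lo) len

searchDown : (ℕ → Bool) → ℕ → Maybe ℕ
searchDown f zero      = nothing
searchDown f (suc len) = if f len then just len else searchDown f len

module Construction (n : ℕ) (t : ℕ → ℚ) (I : Interval) (s : ℕ → Bool) where

  inT : ℕ → ℕ → Bool
  inT i j = isTrue ((t j - t i) ∈I? I)

  first : ℕ → Maybe ℕ
  first i = searchUp (inT i) 0 n

  last : ℕ → Maybe ℕ
  last i = searchDown (inT i) n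

  -- seg(i) = min{ j ≥ i : s(j) = ⊥ }, nothing meaning +∞
  seg : ℕ → Maybe ℕ
  seg i = searchUp (λ j → if s j then false else true) i (n ∸ i)

  R : ℕ → ℕ → ℕ
  R i lst with seg i
  ... | nothing = lst
  ... | just sg = ℕ._⊓_ lst sg

  out : ℕ → Gate
  out i with first i | last i
  ... | just L | just lst =
        if isTrue (L ℕP.≤? R i lst) then idG (d L (R i lst)) else const false
  ... | _ | _ = const false

module Submission where

-- The gate d_{p,q} is the disjunction of the inputs φ_p … φ_q, so o_i fires iff p holds
-- somewhere in [L_i, R_i]. Since t is increasing and I is convex with I ⊆ ℝ≥0, T_i is
-- the block of indices from first(i) to last(i), all ≥ i; and s holds on [i, k) exactly
-- when k ≤ seg(i). So the admissible witnesses j of s U_I p at i are exactly the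
-- indices of [L_i, R_i], and the two sides agree.

open import Defs
open import Data.Bool using (Bool; true; false; _∨_; if_then_else_)
open import Data.Nat using (ℕ; _<_; _≤_; zero; suc; _+_; _∸_; z≤n; s≤s)
import Data.Nat.Properties as ℕP
open import Data.Rational as ℚ using (ℚ; _-_)
import Data.Rational.Properties as ℚP
open import Data.Maybe using (Maybe; just; nothing)
open import Data.Product using (_×_; _,_; Σ; proj₁)
open import Data.Sum using (_⊎_; inj₁; inj₂)
open import Data.Sum.Function.Propositional using (_⊎-⇔_)
open import Data.Unit using (⊤; tt)
open import Data.Empty using (⊥)
open import Function.Bundles using (_⇔_; mk⇔; Equivalence)
import Function.Properties.Equivalence as ⇔
open import Function.Related.Propositional using (module EquationalReasoning)
open import Relation.Nullary using (Dec; yes; no; contradiction)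
open import Relation.Binary.PropositionalEquality

HoldsIn : (ℕ → Bool) → ℕ → ℕ → Set
HoldsIn p a b = Σ ℕ λ k → a ≤ k × k ≤ b × p k ≡ true

∨≡true : ∀ x y → x ∨ y ≡ true ⇔ (x ≡ true ⊎ y ≡ true)
∨≡true true  y     = mk⇔ inj₁ (λ _ → refl)
∨≡true false true  = mk⇔ inj₂ (λ _ → refl)
∨≡true false false = mk⇔ inj₁ (λ { (inj₁ ()) ; (inj₂ ()) })

HoldsIn-split : ∀ p {a b} → a ≤ b → (HoldsIn p a b ⊎ HoldsIn p (suc a) (suc b)) ⇔ HoldsIn p a (suc b)
HoldsIn-split p {a} {b} a≤b = mk⇔ join split
  where
  join : HoldsIn p a b ⊎ HoldsIn p (suc a) (suc b) → HoldsIn p a (suc b)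
  join (inj₁ (k , a≤k , k≤b , pk)) = k , a≤k , ℕP.m≤n⇒m≤1+n k≤b , pk
  join (inj₂ (k , a<k , k≤b+1 , pk)) = k , ℕP.<⇒≤ a<k , k≤b+1 , pk
  split : HoldsIn p a (suc b) → HoldsIn p a b ⊎ HoldsIn p (suc a) (suc b)
  split (k , a≤k , k≤b+1 , pk) with k ℕP.≤? b
  ... | yes k≤b = inj₁ (k , a≤k , k≤b , pk)
  ... | no k≰b  = inj₂ (k , ℕP.≤-<-trans a≤b (ℕP.≰⇒> k≰b) , k≤b+1 , pk)

eval-dSpan : ∀ p a m → eval p (dSpan a m) ≡ true ⇔ HoldsIn p a (a + m)
eval-dSpan p a zero rewrite ℕP.+-identityʳ a = mk⇔
  (λ pa → a , ℕP.≤-refl , ℕP.≤-refl , pa)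
  (λ (k , a≤k , k≤a , pk) → subst (λ i → p i ≡ true) (ℕP.≤-antisym k≤a a≤k) pk)
eval-dSpan p a (suc m) rewrite ℕP.+-suc a m =
  eval p (dSpan a m) ∨ eval p (dSpan (suc a) m) ≡ true
    ∼⟨ ∨≡true _ _ ⟩
  (eval p (dSpan a m) ≡ true ⊎ eval p (dSpan (suc a) m) ≡ true)
    ∼⟨ eval-dSpan p a m ⊎-⇔ eval-dSpan p (suc a) m ⟩
  (HoldsIn p a (a + m) ⊎ HoldsIn p (suc a) (suc (a + m)))
    ∼⟨ HoldsIn-split p (ℕP.m≤m+n a m) ⟩
  HoldsIn p a (suc (a + m)) ∎
  where open EquationalReasoning

eval-d : ∀ p {a b} → a ≤ b → eval p (d a b) ≡ true ⇔ HoldsIn p a b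
eval-d p {a} {b} a≤b =
  subst (λ c → eval p (d a b) ≡ true ⇔ HoldsIn p a c) (ℕP.m+[n∸m]≡n a≤b) (eval-dSpan p a (b ∸ a))

searchUp-just : ∀ f lo len {x} → searchUp f lo len ≡ just x →
  lo ≤ x × x < lo + len × f x ≡ true × (∀ y → lo ≤ y → y < x → f y ≡ false)
searchUp-just f lo (suc len) {x} e with f lo in f-lo
... | true with refl <- e =
  ℕP.≤-refl , ℕP.m<m+n lo (s≤s z≤n) , f-lo , λ y lo≤y y<lo → contradiction lo≤y (ℕP.<⇒≱ y<lo)
... | false with searchUp-just f (suc lo) len e
... | lo<x , x<end , fx , below =
  ℕP.<⇒≤ lo<x , subst (x <_) (sym (ℕP.+-suc lo len)) x<end , fx , minimal
  where
  minimal : ∀ y → lo ≤ y → y < x → f y ≡ false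
  minimal y lo≤y y<x with lo ℕP.≟ y
  ... | yes refl = f-lo
  ... | no lo≢y  = below y (ℕP.≤∧≢⇒< lo≤y lo≢y) y<x

searchUp-nothing : ∀ f lo len → searchUp f lo len ≡ nothing →
  ∀ y → lo ≤ y → y < lo + len → f y ≡ false
searchUp-nothing f lo zero e y lo≤y y<lo =
  contradiction lo≤y (ℕP.<⇒≱ (subst (y <_) (ℕP.+-identityʳ lo) y<lo))
searchUp-nothing f lo (suc len) e y lo≤y y<end with f lo in f-lo
... | false with lo ℕP.≟ y
... | yes refl = f-lo
... | no lo≢y  = searchUp-nothing f (suc lo) len e y (ℕP.≤∧≢⇒< lo≤y lo≢y)
                   (subst (y <_) (ℕP.+-suc lo len) y<end)

searchUp-complete : ∀ f lo len {y} → lo ≤ y → y < lo + len → f y ≡ true →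
  Σ ℕ λ x → searchUp f lo len ≡ just x × x ≤ y
searchUp-complete f lo len {y} lo≤y y<end fy with searchUp f lo len in e
... | nothing = contradiction (trans (sym fy) (searchUp-nothing f lo len e y lo≤y y<end)) λ ()
... | just x with searchUp-just f lo len e
... | _ , _ , _ , below with x ℕP.≤? y
... | yes x≤y = x , refl , x≤y
... | no x≰y  = contradiction (trans (sym fy) (below y lo≤y (ℕP.≰⇒> x≰y))) λ ()

searchDown-just : ∀ f len {x} → searchDown f len ≡ just x →
  x < len × f x ≡ true × (∀ y → x < y → y < len → f y ≡ false)
searchDown-just f (suc len) {x} e with f len in f-len
... | true with refl <- e = ℕP.≤-refl , f-len , λ y x<y y≤x → contradiction y≤x (ℕP.<⇒≱ (s≤s x<y))
... | false with searchDown-just f len e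
... | x<len , fx , above = ℕP.m<n⇒m<1+n x<len , fx , maximal
  where
  maximal : ∀ y → x < y → y < suc len → f y ≡ false
  maximal y x<y y≤len with y ℕP.≟ len
  ... | yes refl = f-len
  ... | no y≢len = above y x<y (ℕP.≤∧≢⇒< (ℕP.≤-pred y≤len) y≢len)

searchDown-nothing : ∀ f len → searchDown f len ≡ nothing → ∀ y → y < len → f y ≡ false
searchDown-nothing f (suc len) e y y≤len with f len in f-len
... | false with y ℕP.≟ len
... | yes refl = f-len
... | no y≢len = searchDown-nothing f len e y (ℕP.≤∧≢⇒< (ℕP.≤-pred y≤len) y≢len)

searchDown-complete : ∀ f len {y} → y < len → f y ≡ true →
  Σ ℕ λ x → searchDown f len ≡ just x × y ≤ x
searchDown-complete f len {y} y<len fy with searchDown f len in e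
... | nothing = contradiction (trans (sym fy) (searchDown-nothing f len e y y<len)) λ ()
... | just x with searchDown-just f len e
... | _ , _ , above with y ℕP.≤? x
... | yes y≤x = x , refl , y≤x
... | no y≰x  = contradiction (trans (sym fy) (above y (ℕP.≰⇒> y≰x) y<len)) λ ()

_≤ᵐ_ : ℕ → Maybe ℕ → Set
k ≤ᵐ nothing = ⊤
k ≤ᵐ just b  = k ≤ b

searchUp-≤ᵐ : ∀ f lo len {k} → k ≤ lo + len →
  (∀ m → lo ≤ m → m < k → f m ≡ false) ⇔ k ≤ᵐ searchUp f lo len
searchUp-≤ᵐ f lo len {k} k≤end with searchUp f lo len in e
... | nothing = mk⇔ (λ _ → tt)
      (λ _ m lo≤m m<k → searchUp-nothing f lo len e m lo≤m (ℕP.<-≤-trans m<k k≤end))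
... | just x with searchUp-just f lo len e
... | lo≤x , _ , fx , below = mk⇔ bounded
      (λ k≤x m lo≤m m<k → below m lo≤m (ℕP.<-≤-trans m<k k≤x))
  where
  bounded : (∀ m → lo ≤ m → m < k → f m ≡ false) → k ≤ x
  bounded none with x ℕP.<? k
  ... | yes x<k = contradiction (trans (sym fx) (none x lo≤x x<k)) λ ()
  ... | no x≮k  = ℕP.≮⇒≥ x≮k

isTrue⇔ : ∀ {A : Set} (a? : Dec A) → isTrue a? ≡ true ⇔ A
isTrue⇔ (yes a)  = mk⇔ (λ _ → a) (λ _ → refl)
isTrue⇔ (no ¬a) = mk⇔ (λ ()) (λ a → contradiction a ¬a)

if-not≡false⇔ : ∀ b → (if b then false else true) ≡ false ⇔ b ≡ true
if-not≡false⇔ true  = mk⇔ (λ _ → refl) (λ _ → refl)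
if-not≡false⇔ false = mk⇔ (λ ()) (λ ())

0≤ℕ→ℚ : ∀ a → ℚ.0ℚ ℚ.≤ ℕ→ℚ a
0≤ℕ→ℚ a = ℚP.nonNegative⁻¹ (ℕ→ℚ a) {{ℚP.normalize-nonNeg a 1}}

∈I⇒nonNegative : ∀ I {x} → x ∈I I → ℚ.0ℚ ℚ.≤ x
∈I⇒nonNegative (interval a true  _ _) (a≤x , _) = ℚP.≤-trans (0≤ℕ→ℚ a) a≤x
∈I⇒nonNegative (interval a false _ _) (a<x , _) = ℚP.≤-trans (0≤ℕ→ℚ a) (ℚP.<⇒≤ a<x)

LowerOK-mono : ∀ c a {x y} → x ℚ.≤ y → LowerOK c a x → LowerOK c a y
LowerOK-mono true  a x≤y a≤x = ℚP.≤-trans a≤x x≤y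
LowerOK-mono false a x≤y a<x = ℚP.<-≤-trans a<x x≤y

UpperOK-antimono : ∀ c b {x y} → x ℚ.≤ y → UpperOK c b y → UpperOK c b x
UpperOK-antimono _     nothing  x≤y _   = tt
UpperOK-antimono true  (just b) x≤y y≤b = ℚP.≤-trans x≤y y≤b
UpperOK-antimono false (just b) x≤y y<b = ℚP.≤-<-trans x≤y y<b

∈I-convex : ∀ I {x y z} → x ℚ.≤ y → y ℚ.≤ z → x ∈I I → z ∈I I → y ∈I I
∈I-convex I x≤y y≤z (x-low , _) (_ , z-up) =
  LowerOK-mono (lowerClosed I) (lower I) x≤y x-low ,
  UpperOK-antimono (upperClosed I) (upper I) y≤z z-up

module Correctness (n : ℕ) (t : ℕ → ℚ) (I : Interval) (s : ℕ → Bool)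
  (increasing : ∀ i j → i < j → j < n → t i ℚ.< t j) where
  open Construction n t I s

  t-mono : ∀ {i k} → i ≤ k → k < n → t i ℚ.≤ t k
  t-mono {i} {k} i≤k k<n with i ℕP.≟ k
  ... | yes refl = ℚP.≤-refl
  ... | no i≢k   = ℚP.<⇒≤ (increasing i k (ℕP.≤∧≢⇒< i≤k i≢k) k<n)

  inT⇔ : ∀ i k → inT i k ≡ true ⇔ (t k - t i) ∈I I
  inT⇔ i k = isTrue⇔ ((t k - t i) ∈I? I)

  inT⇒≤ : ∀ {i k} → i < n → inT i k ≡ true → i ≤ k
  inT⇒≤ {i} {k} i<n k∈T with k ℕP.<? i
  ... | no k≮i = ℕP.≮⇒≥ k≮i
  ... | yes k<i = contradiction
      (ℚP.≤-<-trans (∈I⇒nonNegative I (Equivalence.to (inT⇔ i k) k∈T)) t[k]-t[i]<0)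
      (ℚP.<-irrefl refl)
    where
    t[k]-t[i]<0 : t k - t i ℚ.< ℚ.0ℚ
    t[k]-t[i]<0 = subst (t k - t i ℚ.<_) (ℚP.+-inverseʳ (t i))
                    (ℚP.+-monoˡ-< (ℚ.- t i) (increasing k i k<i i<n))

  inT-convex : ∀ {i a k b} → a ≤ k → k ≤ b → b < n →
    inT i a ≡ true → inT i b ≡ true → inT i k ≡ true
  inT-convex {i} {a} {k} {b} a≤k k≤b b<n a∈T b∈T = Equivalence.from (inT⇔ i k)
    (∈I-convex I (ℚP.+-monoˡ-≤ (ℚ.- t i) (t-mono a≤k (ℕP.≤-<-trans k≤b b<n)))
                 (ℚP.+-monoˡ-≤ (ℚ.- t i) (t-mono k≤b b<n))
                 (Equivalence.to (inT⇔ i a) a∈T) (Equivalence.to (inT⇔ i b) b∈T))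

  s-prefix⇔≤seg : ∀ {i k} → i ≤ n → k ≤ n →
    (∀ m → i ≤ m → m < k → s m ≡ true) ⇔ k ≤ᵐ seg i
  s-prefix⇔≤seg {i} i≤n k≤n = ⇔.trans
    (mk⇔ (λ prefix m i≤m m<k → Equivalence.from (if-not≡false⇔ (s m)) (prefix m i≤m m<k))
         (λ prefix m i≤m m<k → Equivalence.to (if-not≡false⇔ (s m)) (prefix m i≤m m<k)))
    (searchUp-≤ᵐ _ i (n ∸ i) (subst (_ ≤_) (sym (ℕP.m+[n∸m]≡n i≤n)) k≤n))

  ≤R⇔ : ∀ i lst k → k ≤ R i lst ⇔ (k ≤ lst × k ≤ᵐ seg i)
  ≤R⇔ i lst k with seg i
  ... | nothing = mk⇔ (λ k≤lst → k≤lst , tt) proj₁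
  ... | just sg = mk⇔ (λ k≤R → ℕP.m≤n⊓o⇒m≤n lst sg k≤R , ℕP.m≤n⊓o⇒m≤o lst sg k≤R)
                      (λ (k≤lst , k≤sg) → ℕP.⊓-glb k≤lst k≤sg)

  WindowHolds : (ℕ → Bool) → ℕ → Maybe ℕ → Maybe ℕ → Set
  WindowHolds p i (just L) (just lst) = HoldsIn p L (R i lst)
  WindowHolds p i _        _          = ⊥

  eval-out⇔ : ∀ p i → eval p (out i) ≡ true ⇔ WindowHolds p i (first i) (last i)
  eval-out⇔ p i with first i | last i
  ... | nothing | _       = mk⇔ (λ ()) (λ ())
  ... | just L  | nothing = mk⇔ (λ ()) (λ ())
  ... | just L  | just lst with L ℕP.≤? R i lst
  ... | yes L≤R = eval-d p L≤R
  ... | no L≰R  = mk⇔ (λ ()) (λ (k , L≤k , k≤R , _) → contradiction (ℕP.≤-trans L≤k k≤R) L≰R)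

  until⇒window : ∀ p {i} → i < n → UntilHolds n t I s p i → WindowHolds p i (first i) (last i)
  until⇒window p {i} i<n (k , i≤k , k<n , k∈I , pk , prefix)
    with searchUp-complete (inT i) 0 n z≤n k<n k∈T | searchDown-complete (inT i) n k<n k∈T
    where
    k∈T : inT i k ≡ true
    k∈T = Equivalence.from (inT⇔ i k) k∈I
  ... | L , first≡ , L≤k | lst , last≡ , k≤lst rewrite first≡ | last≡ =
    k , L≤k , Equivalence.from (≤R⇔ i lst k) (k≤lst , k≤seg) , pk
    where
    k≤seg : k ≤ᵐ seg i
    k≤seg = Equivalence.to (s-prefix⇔≤seg (ℕP.<⇒≤ i<n) (ℕP.<⇒≤ k<n)) prefix

  window⇒until : ∀ p {i} → i < n → WindowHolds p i (first i) (last i) → UntilHolds n t I s p i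
  window⇒until p {i} i<n with first i in first≡ | last i in last≡
  ... | nothing | _       = λ ()
  ... | just _  | nothing = λ ()
  ... | just L  | just lst = λ (k , L≤k , k≤R , pk) →
    let _ , _ , L∈T , _ = searchUp-just (inT i) 0 n first≡
        lst<n , lst∈T , _ = searchDown-just (inT i) n last≡
        k≤lst , k≤seg = Equivalence.to (≤R⇔ i lst k) k≤R
        k<n = ℕP.≤-<-trans k≤lst lst<n
    in k , ℕP.≤-trans (inT⇒≤ i<n L∈T) L≤k , k<n ,
       Equivalence.to (inT⇔ i k) (inT-convex L≤k k≤lst lst<n L∈T lst∈T) , pk ,
       Equivalence.from (s-prefix⇔≤seg (ℕP.<⇒≤ i<n) (ℕP.<⇒≤ k<n)) k≤seg

lemma3 : (n : ℕ) (t : ℕ → ℚ) (I : Interval) (s : ℕ → Bool)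
    → (∀ i j → i < j → j < n → t i ℚ.< t j)
    → (p : ℕ → Bool) → (j : ℕ) → j < n
    → (eval p (Construction.out n t I s j) ≡ true) ⇔ UntilHolds n t I s p j
lemma3 n t I s increasing p j j<n =
  ⇔.trans (eval-out⇔ p j) (mk⇔ (window⇒until p j<n) (until⇒window p j<n))
  where open Correctness n t I s increasing
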